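{- Let $s = a_1^{m_1}\cdots a_r^{m_r}$ and $t = a_1^{m'_1}\cdots a_r^{m'_r}$ be run-length encodings with the same run symbols $a_1,\ldots,a_r$ (so $a_i\ne a_{i+1}$, $m_i,m'_i\ge1$), and let $D = \{ i : m_i \ne m'_i \}$. Write $\mathcal{F}(s) = [\tau_0,\ldots,\tau_{k-1}]$ and $\mathcal{F}(t) = [\tau'_0,\ldots,\tau'_{k-1}]$. Then the set of depths $d$ with $\tau_d \ne \tau'_d$ is exactly $\{\min(i, r+1-i) : i \in D\}$. In particular, changing a single run length $m_i$ changes exactly one token, at depth $\min(i, r+1-i)$.
   Context: Let $\Sigma$ be an alphabet and let $\texttt{@}$ and $\texttt{\$}$ be two distinct symbols not in $\Sigma$; $a^m$ denotes $a$ repeated $m$ times. For $s\in\Sigma^*$ let $\hat{s} = \texttt{@}\,s\,\texttt{\$}$. The leading (resp. trailing) run of a non-empty string is its longest prefix (resp. suffix) consisting of a single repeated symbol. A bilateral token is a pair $(\sigma,p)$ with $\sigma$ a non-empty string and $p\in\mathbb{N}_0$. The Flashback decomposition $\mathcal{F}(s) = [\tau_0,\ldots,\tau_{k-1}]$ is produced starting with active span $\hat{s}$: (i) if the span is empty, stop; (ii) let $\ell$ be its leading run length; if $\ell$ equals the span length, append (span, $0$) and stop; (iii) otherwise let $\sigma$ be the leading run followed by the trailing run and the middle the span with both removed; if the middle is empty append $(\sigma,0)$ and stop, else append $(\sigma,\ell)$ and continue on the middle. The index $d$ of $\tau_d$ is its depth; tokens at depths $\ge 1$ are content tokens. (Since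 $s$ and $t$ have the same number $r$ of runs, both decompositions have the same length $k$.) -}

module Defs where

open import Data.Nat using (ℕ; zero; suc; _∸_; _≟_)
open import Data.List using (List; []; _∷_; length; takeWhile; reverse; take; drop; _++_; concat; map)
open import Data.Product using (_×_; _,_)
open import Data.Maybe using (Maybe; just; nothing)
open import Data.Vec using (Vec; toList; zipWith)
open import Relation.Nullary using (yes; no)
open import Relation.Binary.PropositionalEquality using (_≡_; refl)
open import Relation.Binary.Definitions using (DecidableEquality)

data Sym (A : Set) : Set where
  at     : Sym A
  dollar : Sym A
  ch     : A → Sym A

module _ {A : Set} (_≟A_ : DecidableEquality A) where

  _≟S_ : DecidableEquality (Sym A)
  at ≟S at = yes refl
  at ≟S dollar = no λ ()
  at ≟S ch _ = no λ ()
  dollar ≟S at = no λ ()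
  dollar ≟S dollar = yes refl
  dollar ≟S ch _ = no λ ()
  ch _ ≟S at = no λ ()
  ch _ ≟S dollar = no λ ()
  ch a ≟S ch b with a ≟A b
  ... | yes refl = yes refl
  ... | no a≢b = no λ { refl → a≢b refl }

  leadLen : List (Sym A) → ℕ
  leadLen [] = 0
  leadLen (x ∷ xs) = suc (length (takeWhile (x ≟S_) xs))

  trailLen : List (Sym A) → ℕ
  trailLen w = leadLen (reverse w)

  Token : Set
  Token = List (Sym A) × ℕ

  -- Flashback decomposition of an active span, with fuel (each step strictly
  -- shortens the span, so fuel = length of the span suffices)
  flashbackSpan : ℕ → List (Sym A) → List Token
  flashbackSpan zero _ = []
  flashbackSpan (suc n) [] = []
  flashbackSpan (suc n) w@(_ ∷ _) with leadLen w ≟ length w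
  ... | yes _ = (w , 0) ∷ []
  ... | no _ with drop (leadLen w) (take (length w ∸ trailLen w) w)
  ...   | [] = (take (leadLen w) w ++ drop (length w ∸ trailLen w) w , 0) ∷ []
  ...   | mid@(_ ∷ _) =
            (take (leadLen w) w ++ drop (length w ∸ trailLen w) w , leadLen w)
              ∷ flashbackSpan n mid

  hat : List A → List (Sym A)
  hat s = at ∷ (map ch s Data.List.++ (dollar ∷ []))

  flashback : List A → List Token
  flashback s = flashbackSpan (length (hat s)) (hat s)

rep : {A : Set} → ℕ → A → List A
rep zero a = []
rep (suc m) a = a ∷ rep m a

expand : {A : Set} {r : ℕ} → Vec A r → Vec ℕ r → List A
expand as ms = concat (toList (zipWith (λ a m → rep m a) as ms))

_!?_ : {B : Set} → List B → ℕ → Maybe B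
[] !? _ = nothing
(x ∷ xs) !? zero = just x
(x ∷ xs) !? suc d = xs !? d

{-# OPTIONS --safe #-}
-- ŝ = @ s $ is the sequence of q = r + 2 runs c 0 ^ n 0 ⋯ c (q-1) ^ n (q-1) with c 0 = @ and
-- c (q-1) = $ occurring once. As adjacent runs have distinct symbols, the leading and trailing
-- runs of every active span are whole runs of ŝ, so Flashback peels the runs off in pairs from
-- the outside in: the token at depth d is (c d ^ n d · c (q-1-d) ^ n (q-1-d) , n d), with index
-- 0 once nothing is left inside. This token determines both run lengths (the first through the
-- index or, when the index is 0, through the distinctness of the two symbols), so it changes
-- exactly when run d or run q-1-d does; run i of s is run i of ŝ, at depth min(i, r+1-i).
module Submission where

open import Defs
open import Data.Nat using (ℕ; zero; suc; _∸_; _⊓_; _≥_; _+_; _≤_; _<_; z≤n; s≤s; z<s; _≟_)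
open import Data.Nat.Properties
  using ( +-comm; +-∸-assoc; n∸n≡0; ⊓-zeroʳ; suc-injective; 1+n≢0; <⇒≢; m<n⇒m<1+n
        ; m≤n⇒m<n∨m≡n; m≤m+n; m<m+n; m+n∸n≡m; +-mono-≤; ≤-refl; ≤-trans; ≤-<-trans; n≤1+n; ≤-pred)
open import Data.Fin as Fin using (Fin; toℕ)
open import Data.Fin.Properties using (toℕ<n)
open import Data.Vec as Vec using (Vec; lookup; []; _∷_)
open import Data.Vec.Properties using (lookup-map)
open import Data.List using (List; []; _∷_; [_]; length; takeWhile; reverse; take; drop; _++_; map; head)
open import Data.List.Properties
  using (++-assoc; ++-identityʳ; ++-cancelˡ; length-++; reverse-++; unfold-reverse; map-++; ∷-injectiveˡ; ∷-injectiveʳ)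
open import Data.Maybe using (just)
open import Data.Maybe.Properties using (just-injective)
open import Data.Product using (Σ; _×_; _,_; proj₁; proj₂)
open import Data.Sum using (_⊎_; inj₁; inj₂)
open import Data.Empty using (⊥-elim)
open import Function using (_∘_)
open import Function.Bundles using (_⇔_; mk⇔)
open import Function.Properties.Equivalence using () renaming (trans to ⇔-trans; sym to ⇔-sym)
open import Relation.Nullary using (yes; no)
open import Relation.Binary.PropositionalEquality using (_≡_; _≢_; refl; sym; trans; cong; cong₂; subst; module ≡-Reasoning)
open import Relation.Binary.Definitions using (DecidableEquality)

open ≡-Reasoning

Positive : (ℕ → ℕ) → Set
Positive n = ∀ i → 1 ≤ n i

tokenIndex : (middle ℓ : ℕ) → ℕ
tokenIndex zero    ℓ = 0
tokenIndex (suc _) ℓ = ℓ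

module _ {X : Set} where

  take-length-++ : ∀ (xs ys : List X) → take (length xs) (xs ++ ys) ≡ xs
  take-length-++ []       ys = refl
  take-length-++ (x ∷ xs) ys = cong (x ∷_) (take-length-++ xs ys)

  drop-length-++ : ∀ (xs ys : List X) → drop (length xs) (xs ++ ys) ≡ ys
  drop-length-++ []       ys = refl
  drop-length-++ (x ∷ xs) ys = drop-length-++ xs ys

  length-rep : ∀ k (x : X) → length (rep k x) ≡ k
  length-rep zero    x = refl
  length-rep (suc k) x = cong suc (length-rep k x)

  rep-injective : ∀ {k k′} {x : X} → rep k x ≡ rep k′ x → k ≡ k′
  rep-injective {k} {k′} {x} eq = trans (sym (length-rep k x)) (trans (cong length eq) (length-rep k′ x))

  reverse-rep : ∀ k (x : X) → reverse (rep k x) ≡ rep k x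
  reverse-rep zero    x = refl
  reverse-rep (suc k) x = begin
    reverse (x ∷ rep k x)    ≡⟨ unfold-reverse x (rep k x) ⟩
    reverse (rep k x) ++ [ x ] ≡⟨ cong (_++ [ x ]) (reverse-rep k x) ⟩
    rep k x ++ [ x ]         ≡⟨ rep-snoc k ⟩
    x ∷ rep k x              ∎
    where
    rep-snoc : ∀ k → rep k x ++ [ x ] ≡ x ∷ rep k x
    rep-snoc zero    = refl
    rep-snoc (suc k) = cong (x ∷_) (rep-snoc k)

  head-rep-++ : ∀ {k} {x : X} {v} → 1 ≤ k → head (rep k x ++ v) ≡ just x
  head-rep-++ {suc k} _ = refl

  rep-++-injectiveˡ : ∀ {x y : X} → x ≢ y →
    ∀ a b a′ b′ → rep a x ++ rep b y ≡ rep a′ x ++ rep b′ y → a ≡ a′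
  rep-++-injectiveˡ x≢y zero    _       zero     _        _  = refl
  rep-++-injectiveˡ x≢y zero    zero    (suc a′) _        ()
  rep-++-injectiveˡ x≢y zero    (suc b) (suc a′) _        eq = ⊥-elim (x≢y (sym (∷-injectiveˡ eq)))
  rep-++-injectiveˡ x≢y (suc a) _       zero     zero     ()
  rep-++-injectiveˡ x≢y (suc a) _       zero     (suc b′) eq = ⊥-elim (x≢y (∷-injectiveˡ eq))
  rep-++-injectiveˡ x≢y (suc a) b       (suc a′) b′       eq =
    cong suc (rep-++-injectiveˡ x≢y a b a′ b′ (∷-injectiveʳ eq))

  map-rep : ∀ {Y : Set} (f : X → Y) k x → map f (rep k x) ≡ rep k (f x)
  map-rep f zero    x = refl
  map-rep f (suc k) x = cong (f x ∷_) (map-rep f k x)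

  runString : (ℕ → X) → (ℕ → ℕ) → ℕ → List X
  runString c n zero    = []
  runString c n (suc q) = rep (n 0) (c 0) ++ runString (c ∘ suc) (n ∘ suc) q

  Alternating : (ℕ → X) → ℕ → Set
  Alternating c q = ∀ i → suc i < q → c i ≢ c (suc i)

  Alternating-inner : ∀ {c q} → Alternating c (2 + q) → Alternating (c ∘ suc) q
  Alternating-inner alt i i<q = alt (suc i) (s≤s (m<n⇒m<1+n i<q))

  runString-suc : ∀ c n q → runString c n (suc q) ≡ runString c n q ++ rep (n q) (c q)
  runString-suc c n zero    = ++-identityʳ (rep (n 0) (c 0))
  runString-suc c n (suc q) = begin
    rep (n 0) (c 0) ++ runString (c ∘ suc) (n ∘ suc) (suc q)
      ≡⟨ cong (rep (n 0) (c 0) ++_) (runString-suc (c ∘ suc) (n ∘ suc) q) ⟩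
    rep (n 0) (c 0) ++ (runString (c ∘ suc) (n ∘ suc) q ++ rep (n (suc q)) (c (suc q)))
      ≡⟨ ++-assoc (rep (n 0) (c 0)) _ _ ⟨
    runString c n (suc q) ++ rep (n (suc q)) (c (suc q)) ∎

  reverse-runString-suc : ∀ c n q → reverse (runString c n (suc q)) ≡ rep (n q) (c q) ++ reverse (runString c n q)
  reverse-runString-suc c n q = begin
    reverse (runString c n (suc q))                      ≡⟨ cong reverse (runString-suc c n q) ⟩
    reverse (runString c n q ++ rep (n q) (c q))         ≡⟨ reverse-++ (runString c n q) _ ⟩
    reverse (rep (n q) (c q)) ++ reverse (runString c n q) ≡⟨ cong (_++ reverse (runString c n q)) (reverse-rep (n q) (c q)) ⟩
    rep (n q) (c q) ++ reverse (runString c n q)         ∎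

  head-reverse-runString : ∀ c n q → Positive n → head (reverse (runString c n (suc q))) ≡ just (c q)
  head-reverse-runString c n q pos = trans (cong head (reverse-runString-suc c n q)) (head-rep-++ (pos q))

  length-runString : ∀ c n q → Positive n → q ≤ length (runString c n q)
  length-runString c n zero    pos = z≤n
  length-runString c n (suc q) pos =
    subst (suc q ≤_) (sym split) (+-mono-≤ (pos 0) (length-runString (c ∘ suc) (n ∘ suc) q (pos ∘ suc)))
    where
    split : length (runString c n (suc q)) ≡ n 0 + length (runString (c ∘ suc) (n ∘ suc) q)
    split = trans (length-++ (rep (n 0) (c 0)))
                  (cong (_+ length (runString (c ∘ suc) (n ∘ suc) q)) (length-rep (n 0) (c 0)))

  tokenIndex-length-runString : ∀ c n q {ℓ} → Positive n → tokenIndex (length (runString c n q)) ℓ ≡ tokenIndex q ℓ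
  tokenIndex-length-runString c n zero    pos = refl
  tokenIndex-length-runString c n (suc q) pos with length (runString c n (suc q)) | length-runString c n (suc q) pos
  ... | suc _ | _ = refl

  outerToken : (x y : X) (middle a b : ℕ) → List X × ℕ
  outerToken x y middle a b = (rep a x ++ rep b y , tokenIndex middle a)

  tokens : (ℕ → X) → (ℕ → ℕ) → ℕ → List (List X × ℕ)
  tokens c n zero          = []
  tokens c n (suc zero)    = (rep (n 0) (c 0) , 0) ∷ []
  tokens c n (suc (suc q)) = outerToken (c 0) (c (suc q)) q (n 0) (n (suc q)) ∷ tokens (c ∘ suc) (n ∘ suc) q

module _ {A : Set} (_≟A_ : DecidableEquality A) where

  takeWhile-rep-++ : ∀ k (x : Sym A) v →
    takeWhile (_≟S_ _≟A_ x) (rep k x ++ v) ≡ rep k x ++ takeWhile (_≟S_ _≟A_ x) v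
  takeWhile-rep-++ zero    x v = refl
  takeWhile-rep-++ (suc k) x v with _≟S_ _≟A_ x x
  ... | yes _  = cong (x ∷_) (takeWhile-rep-++ k x v)
  ... | no x≢x = ⊥-elim (x≢x refl)

  takeWhile-head≢ : ∀ (x : Sym A) v → head v ≢ just x → takeWhile (_≟S_ _≟A_ x) v ≡ []
  takeWhile-head≢ x []      _ = refl
  takeWhile-head≢ x (y ∷ v) y≢x with _≟S_ _≟A_ x y
  ... | yes refl = ⊥-elim (y≢x refl)
  ... | no _     = refl

  leadLen-rep-++ : ∀ {k} {x : Sym A} {v} → 1 ≤ k → head v ≢ just x → leadLen _≟A_ (rep k x ++ v) ≡ k
  leadLen-rep-++ {suc k} {x} {v} _ v≢x = cong suc (begin
    length (takeWhile (_≟S_ _≟A_ x) (rep k x ++ v))       ≡⟨ cong length (takeWhile-rep-++ k x v) ⟩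
    length (rep k x ++ takeWhile (_≟S_ _≟A_ x) v)         ≡⟨ cong (λ t → length (rep k x ++ t)) (takeWhile-head≢ x v v≢x) ⟩
    length (rep k x ++ [])                                ≡⟨ cong length (++-identityʳ (rep k x)) ⟩
    length (rep k x)                                      ≡⟨ length-rep k x ⟩
    k                                                     ∎)

  leadLen-runString : ∀ c n q → Positive n → Alternating c (suc q) → leadLen _≟A_ (runString c n (suc q)) ≡ n 0
  leadLen-runString c n q pos alt = leadLen-rep-++ (pos 0) (next≢ q alt)
    where
    next≢ : ∀ q → Alternating c (suc q) → head (runString (c ∘ suc) (n ∘ suc) q) ≢ just (c 0)
    next≢ zero    alt ()
    next≢ (suc q) alt eq = alt 0 (s≤s z<s) (sym (just-injective (trans (sym (head-rep-++ (pos 1))) eq)))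

  trailLen-runString : ∀ c n q → Positive n → Alternating c (suc q) → trailLen _≟A_ (runString c n (suc q)) ≡ n q
  trailLen-runString c n q pos alt =
    trans (cong (leadLen _≟A_) (reverse-runString-suc c n q)) (leadLen-rep-++ (pos q) (previous≢ q alt))
    where
    previous≢ : ∀ q → Alternating c (suc q) → head (reverse (runString c n q)) ≢ just (c q)
    previous≢ zero    alt ()
    previous≢ (suc q) alt eq = alt q ≤-refl (just-injective (trans (sym (head-reverse-runString c n q pos)) eq))

  flashbackSpan-[] : ∀ f → flashbackSpan _≟A_ f [] ≡ []
  flashbackSpan-[] zero    = refl
  flashbackSpan-[] (suc f) = refl

  flashbackSpan-whole : ∀ f w → 1 ≤ length w → leadLen _≟A_ w ≡ length w →
    flashbackSpan _≟A_ (suc f) w ≡ (w , 0) ∷ []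
  flashbackSpan-whole f w@(_ ∷ _) _ whole with leadLen _≟A_ w ≟ length w
  ... | yes _       = refl
  ... | no  partial = ⊥-elim (partial whole)

  -- Step (iii), whether or not the middle is empty: for an empty middle, flashbackSpan f [] = [].
  flashbackSpan-partial : ∀ f w → leadLen _≟A_ w ≢ length w →
    let ℓ   = leadLen _≟A_ w
        j   = length w ∸ trailLen _≟A_ w
        mid = drop ℓ (take j w)
    in flashbackSpan _≟A_ (suc f) w ≡ (take ℓ w ++ drop j w , tokenIndex (length mid) ℓ) ∷ flashbackSpan _≟A_ f mid
  flashbackSpan-partial f []         partial = ⊥-elim (partial refl)
  flashbackSpan-partial f w@(_ ∷ _) partial with leadLen _≟A_ w ≟ length w
  ... | yes whole = ⊥-elim (partial whole)
  ... | no _ with drop (leadLen _≟A_ w) (take (length w ∸ trailLen _≟A_ w) w)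
  ...   | []    = cong (_ ∷_) (sym (flashbackSpan-[] f))
  ...   | _ ∷ _ = refl

  flashbackSpan-peel : ∀ f {u} R₀ M Rₗ → u ≡ R₀ ++ M ++ Rₗ → 1 ≤ length Rₗ →
    leadLen _≟A_ u ≡ length R₀ → trailLen _≟A_ u ≡ length Rₗ →
    flashbackSpan _≟A_ (suc f) u ≡ (R₀ ++ Rₗ , tokenIndex (length M) (length R₀)) ∷ flashbackSpan _≟A_ f M
  flashbackSpan-peel f R₀ M Rₗ refl nonempty lead trail = begin
    flashbackSpan _≟A_ (suc f) u
      ≡⟨ flashbackSpan-partial f u partial ⟩
    peelAt (leadLen _≟A_ u) (length u ∸ trailLen _≟A_ u)
      ≡⟨ cong₂ peelAt lead cut ⟩
    peelAt (length R₀) (length (R₀ ++ M))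
      ≡⟨ cong₂ (step (length R₀)) (cong₂ _++_ (take-length-++ R₀ (M ++ Rₗ)) drop-trail) middle ⟩
    step (length R₀) (R₀ ++ Rₗ) M ∎
    where
    u = R₀ ++ M ++ Rₗ

    step : ℕ → List (Sym A) → List (Sym A) → List (Token _≟A_)
    step ℓ σ mid = (σ , tokenIndex (length mid) ℓ) ∷ flashbackSpan _≟A_ f mid

    peelAt : ℕ → ℕ → List (Token _≟A_)
    peelAt ℓ j = step ℓ (take ℓ u ++ drop j u) (drop ℓ (take j u))

    reassoc : u ≡ (R₀ ++ M) ++ Rₗ
    reassoc = sym (++-assoc R₀ M Rₗ)

    length-u : length u ≡ length (R₀ ++ M) + length Rₗ
    length-u = trans (cong length reassoc) (length-++ (R₀ ++ M))

    partial : leadLen _≟A_ u ≢ length u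
    partial whole = <⇒≢ R₀-shorter (trans (sym lead) whole)
      where
      R₀-shorter : length R₀ < length u
      R₀-shorter = subst (length R₀ <_) (sym length-u) (≤-<-trans prefix (m<m+n _ nonempty))
        where
        prefix : length R₀ ≤ length (R₀ ++ M)
        prefix = subst (length R₀ ≤_) (sym (length-++ R₀)) (m≤m+n (length R₀) (length M))

    cut : length u ∸ trailLen _≟A_ u ≡ length (R₀ ++ M)
    cut = trans (cong₂ _∸_ length-u trail) (m+n∸n≡m (length (R₀ ++ M)) (length Rₗ))

    drop-trail : drop (length (R₀ ++ M)) u ≡ Rₗ
    drop-trail = trans (cong (drop (length (R₀ ++ M))) reassoc) (drop-length-++ (R₀ ++ M) Rₗ)

    middle : drop (length R₀) (take (length (R₀ ++ M)) u) ≡ M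
    middle = trans (cong (λ t → drop (length R₀) (take (length (R₀ ++ M)) t)) reassoc)
                   (trans (cong (drop (length R₀)) (take-length-++ (R₀ ++ M) Rₗ)) (drop-length-++ R₀ M))

  flashbackSpan-runString : ∀ c n q {f} → q ≤ f → Positive n → Alternating c q →
    flashbackSpan _≟A_ f (runString c n q) ≡ tokens c n q
  flashbackSpan-runString c n zero          {f}     _  pos alt = flashbackSpan-[] f
  flashbackSpan-runString c n (suc zero)    {suc f} _  pos alt = begin
    flashbackSpan _≟A_ (suc f) (rep (n 0) (c 0) ++ [])
      ≡⟨ flashbackSpan-whole f _ (length-runString c n 1 pos) (trans (leadLen-runString c n 0 pos alt) (sym single)) ⟩
    (rep (n 0) (c 0) ++ [] , 0) ∷ []
      ≡⟨ cong (λ w → (w , 0) ∷ []) (++-identityʳ (rep (n 0) (c 0))) ⟩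
    tokens c n 1 ∎
    where
    single : length (rep (n 0) (c 0) ++ []) ≡ n 0
    single = trans (cong length (++-identityʳ (rep (n 0) (c 0)))) (length-rep (n 0) (c 0))
  flashbackSpan-runString c n (suc (suc q)) {suc f} q≤f pos alt = begin
    flashbackSpan _≟A_ (suc f) (runString c n (2 + q))
      ≡⟨ flashbackSpan-peel f R₀ M Rₗ (cong (R₀ ++_) (runString-suc (c ∘ suc) (n ∘ suc) q))
           (subst (1 ≤_) (sym (length-rep _ _)) (pos (suc q)))
           (trans (leadLen-runString c n (suc q) pos alt) (sym (length-rep _ _)))
           (trans (trailLen-runString c n (suc q) pos alt) (sym (length-rep _ _))) ⟩
    (R₀ ++ Rₗ , tokenIndex (length M) (length R₀)) ∷ flashbackSpan _≟A_ f M
      ≡⟨ cong₂ (λ p ts → (R₀ ++ Rₗ , p) ∷ ts) index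
           (flashbackSpan-runString (c ∘ suc) (n ∘ suc) q (≤-trans (n≤1+n q) (≤-pred q≤f))
              (pos ∘ suc) (Alternating-inner alt)) ⟩
    tokens c n (2 + q) ∎
    where
    R₀ = rep (n 0) (c 0)
    M  = runString (c ∘ suc) (n ∘ suc) q
    Rₗ = rep (n (suc q)) (c (suc q))

    index : tokenIndex (length M) (length R₀) ≡ tokenIndex q (n 0)
    index = trans (tokenIndex-length-runString (c ∘ suc) (n ∘ suc) q (pos ∘ suc)) (cong (tokenIndex q) (length-rep (n 0) (c 0)))

depth : (q i : ℕ) → ℕ
depth q i = i ⊓ (q ∸ suc i)

depth-last : ∀ q → depth (suc q) q ≡ 0
depth-last q = trans (cong (q ⊓_) (n∸n≡0 q)) (⊓-zeroʳ q)

depth-inner : ∀ {q i} → i < q → depth (2 + q) (suc i) ≡ suc (depth q i)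
depth-inner {i = i} i<q = cong (suc i ⊓_) (+-∸-assoc 1 i<q)

data RunPosition (q : ℕ) : ℕ → Set where
  first : RunPosition q 0
  inner : ∀ {i} → i < q → RunPosition q (suc i)
  last  : RunPosition q (suc q)

runPosition : ∀ {q i} → i < 2 + q → RunPosition q i
runPosition {i = zero}  _               = first
runPosition {i = suc i} (s≤s (s≤s i≤q)) with m≤n⇒m<n∨m≡n i≤q
... | inj₁ i<q  = inner i<q
... | inj₂ refl = last

ChangedRunAt : (n n′ : ℕ → ℕ) (q d : ℕ) → Set
ChangedRunAt n n′ q d = Σ ℕ λ i → i < q × n i ≢ n′ i × d ≡ depth q i

module _ {n n′ : ℕ → ℕ} {q : ℕ} where

  ChangedRunAt-outer : ChangedRunAt n n′ (2 + q) 0 ⇔ (n 0 ≢ n′ 0 ⊎ n (suc q) ≢ n′ (suc q))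
  ChangedRunAt-outer = mk⇔ to from
    where
    to : ChangedRunAt n n′ (2 + q) 0 → n 0 ≢ n′ 0 ⊎ n (suc q) ≢ n′ (suc q)
    to (i , i< , ≢ , 0≡) with runPosition i<
    ... | first     = inj₁ ≢
    ... | inner i<q = ⊥-elim (1+n≢0 (sym (trans 0≡ (depth-inner i<q))))
    ... | last      = inj₂ ≢

    from : n 0 ≢ n′ 0 ⊎ n (suc q) ≢ n′ (suc q) → ChangedRunAt n n′ (2 + q) 0
    from (inj₁ ≢) = 0 , z<s , ≢ , refl
    from (inj₂ ≢) = suc q , ≤-refl , ≢ , sym (depth-last (suc q))

  ChangedRunAt-inner : ∀ {d} → ChangedRunAt n n′ (2 + q) (suc d) ⇔ ChangedRunAt (n ∘ suc) (n′ ∘ suc) q d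
  ChangedRunAt-inner {d} = mk⇔ to from
    where
    to : ChangedRunAt n n′ (2 + q) (suc d) → ChangedRunAt (n ∘ suc) (n′ ∘ suc) q d
    to (i , i< , ≢ , d≡) with runPosition i<
    ... | first     = ⊥-elim (1+n≢0 d≡)
    ... | inner i<q = _ , i<q , ≢ , suc-injective (trans d≡ (depth-inner i<q))
    ... | last      = ⊥-elim (1+n≢0 (trans d≡ (depth-last (suc q))))

    from : ChangedRunAt (n ∘ suc) (n′ ∘ suc) q d → ChangedRunAt n n′ (2 + q) (suc d)
    from (i , i<q , ≢ , d≡) = suc i , s≤s (m<n⇒m<1+n i<q) , ≢ , trans (cong suc d≡) (sym (depth-inner i<q))

module _ {X : Set} where

  outerToken-injectiveˡ : ∀ {x y : X} q {a b a′ b′} → (q ≡ 0 → x ≢ y) →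
    outerToken x y q a b ≡ outerToken x y q a′ b′ → a ≡ a′
  outerToken-injectiveˡ zero    {a} {b} {a′} {b′} x≢y eq = rep-++-injectiveˡ (x≢y refl) a b a′ b′ (cong proj₁ eq)
  outerToken-injectiveˡ (suc q)                   _   eq = cong proj₂ eq

  outerToken-injective : ∀ {x y : X} q {a b a′ b′} → (q ≡ 0 → x ≢ y) →
    outerToken x y q a b ≡ outerToken x y q a′ b′ → a ≡ a′ × b ≡ b′
  outerToken-injective {x} {y} q {a} {b} {a′} {b′} x≢y eq with outerToken-injectiveˡ q x≢y eq
  ... | refl = refl , rep-injective (++-cancelˡ (rep a x) (rep b y) (rep b′ y) (cong proj₁ eq))

  outerToken-≢⇔ : ∀ {c : ℕ → X} {n n′} q → Alternating c (2 + q) →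
    (tokens c n (2 + q) !? 0 ≢ tokens c n′ (2 + q) !? 0) ⇔ (n 0 ≢ n′ 0 ⊎ n (suc q) ≢ n′ (suc q))
  outerToken-≢⇔ {c} {n} {n′} q alt = mk⇔ to from
    where
    to : tokens c n (2 + q) !? 0 ≢ tokens c n′ (2 + q) !? 0 → n 0 ≢ n′ 0 ⊎ n (suc q) ≢ n′ (suc q)
    to ≢ with n 0 ≟ n′ 0 | n (suc q) ≟ n′ (suc q)
    ... | no ≢₀   | _        = inj₁ ≢₀
    ... | yes _   | no ≢ₗ    = inj₂ ≢ₗ
    ... | yes ≡₀  | yes ≡ₗ   = ⊥-elim (≢ (cong₂ (λ a b → just (outerToken (c 0) (c (suc q)) q a b)) ≡₀ ≡ₗ))

    ends≢ : q ≡ 0 → c 0 ≢ c (suc q)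
    ends≢ q≡0 = subst (λ k → c 0 ≢ c (suc k)) (sym q≡0) (alt 0 (s≤s z<s))

    from : n 0 ≢ n′ 0 ⊎ n (suc q) ≢ n′ (suc q) → tokens c n (2 + q) !? 0 ≢ tokens c n′ (2 + q) !? 0
    from (inj₁ ≢₀) = ≢₀ ∘ proj₁ ∘ outerToken-injective q ends≢ ∘ just-injective
    from (inj₂ ≢ₗ) = ≢ₗ ∘ proj₂ ∘ outerToken-injective q ends≢ ∘ just-injective

  tokens-≢⇔ChangedRunAt : ∀ {c : ℕ → X} {n n′} q d → Alternating c q →
    (tokens c n q !? d ≢ tokens c n′ q !? d) ⇔ ChangedRunAt n n′ q d
  tokens-≢⇔ChangedRunAt zero d _ =
    mk⇔ (λ ≢ → ⊥-elim (≢ refl)) λ ()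
  tokens-≢⇔ChangedRunAt {c} (suc zero) zero _ =
    mk⇔ (λ ≢ → 0 , z<s , ≢ ∘ cong (λ k → just (rep k (c 0) , 0)) , refl)
        λ { (zero , _ , ≢ , _) → ≢ ∘ rep-injective ∘ cong proj₁ ∘ just-injective ; (suc _ , s≤s () , _) }
  tokens-≢⇔ChangedRunAt (suc zero) (suc d) _ =
    mk⇔ (λ ≢ → ⊥-elim (≢ refl)) λ { (zero , _ , _ , ()) }
  tokens-≢⇔ChangedRunAt {n = n} {n′} (suc (suc q)) zero alt =
    ⇔-trans (outerToken-≢⇔ {n = n} {n′} q alt) (⇔-sym ChangedRunAt-outer)
  tokens-≢⇔ChangedRunAt (suc (suc q)) (suc d) alt =
    ⇔-trans (tokens-≢⇔ChangedRunAt q d (Alternating-inner alt)) (⇔-sym ChangedRunAt-inner)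

module _ {B : Set} where

  lookupOr : ∀ {r} → B → Vec B r → ℕ → B
  lookupOr z []       _       = z
  lookupOr z (x ∷ xs) zero    = x
  lookupOr z (x ∷ xs) (suc i) = lookupOr z xs i

  lookupOr-beyond : ∀ {r} z (v : Vec B r) → lookupOr z v r ≡ z
  lookupOr-beyond z []       = refl
  lookupOr-beyond z (x ∷ xs) = lookupOr-beyond z xs

  lookupOr-toℕ : ∀ {r} z (v : Vec B r) j → lookupOr z v (toℕ j) ≡ lookup v j
  lookupOr-toℕ z (x ∷ xs) Fin.zero    = refl
  lookupOr-toℕ z (x ∷ xs) (Fin.suc j) = lookupOr-toℕ z xs j

  lookupOr-preserves : ∀ {r} (P : B → Set) z (v : Vec B r) → P z → (∀ j → P (lookup v j)) → ∀ i → P (lookupOr z v i)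
  lookupOr-preserves P z []       Pz Pv i       = Pz
  lookupOr-preserves P z (x ∷ xs) Pz Pv zero    = Pv Fin.zero
  lookupOr-preserves P z (x ∷ xs) Pz Pv (suc i) = lookupOr-preserves P z xs Pz (Pv ∘ Fin.suc) i

  lookupOr-≢ : ∀ {r} {z} (v v′ : Vec B r) i → lookupOr z v i ≢ lookupOr z v′ i →
    Σ (Fin r) λ j → toℕ j ≡ i × lookup v j ≢ lookup v′ j
  lookupOr-≢ []       []         i       ≢ = ⊥-elim (≢ refl)
  lookupOr-≢ (x ∷ xs) (x′ ∷ xs′) zero    ≢ = Fin.zero , refl , ≢
  lookupOr-≢ (x ∷ xs) (x′ ∷ xs′) (suc i) ≢ with lookupOr-≢ xs xs′ i ≢
  ... | j , refl , ≢j = Fin.suc j , refl , ≢j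

-- The runs of ŝ: reading past the end of a (resp. m) supplies the closing run $ (of length 1).
hatLengths : ∀ {r} → Vec ℕ r → ℕ → ℕ
hatLengths m zero    = 1
hatLengths m (suc i) = lookupOr 1 m i

hatLengths-positive : ∀ {r} (m : Vec ℕ r) → (∀ j → lookup m j ≥ 1) → Positive (hatLengths m)
hatLengths-positive m pos zero    = ≤-refl
hatLengths-positive m pos (suc i) = lookupOr-preserves (1 ≤_) 1 m ≤-refl pos i

module _ {A : Set} where

  AdjacentDistinct : ∀ {r} → Vec A r → Set
  AdjacentDistinct {r} a = (i j : Fin r) → toℕ j ≡ suc (toℕ i) → lookup a i ≢ lookup a j

  hatSymbols : ∀ {r} → Vec A r → ℕ → Sym A
  hatSymbols a zero    = at
  hatSymbols a (suc i) = lookupOr dollar (Vec.map ch a) i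

  map-expand : ∀ {B : Set} {r} (f : A → B) z k (a : Vec A r) m →
    map f (expand a m) ≡ runString (lookupOr z (Vec.map f a)) (lookupOr k m) r
  map-expand f z k []       []       = refl
  map-expand f z k (x ∷ xs) (l ∷ ls) =
    trans (map-++ f (rep l x) (expand xs ls)) (cong₂ _++_ (map-rep f l x) (map-expand f z k xs ls))

  hat-expand : ∀ {r} (_≟A_ : DecidableEquality A) (a : Vec A r) m →
    hat _≟A_ (expand a m) ≡ runString (hatSymbols a) (hatLengths m) (2 + r)
  hat-expand {r} _ a m = cong (at ∷_) (begin
    map ch (expand a m) ++ [ dollar ]       ≡⟨ cong (_++ [ dollar ]) (map-expand ch dollar 1 a m) ⟩
    runString c n r ++ rep 1 dollar         ≡⟨ cong₂ (λ k s → runString c n r ++ rep k s)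
                                                     (sym (lookupOr-beyond 1 m)) (sym (lookupOr-beyond dollar (Vec.map ch a))) ⟩
    runString c n r ++ rep (n r) (c r)      ≡⟨ runString-suc c n r ⟨
    runString c n (suc r)                   ∎)
    where
    c = lookupOr dollar (Vec.map ch a)
    n = lookupOr 1 m

  hatSymbols-alternating : ∀ {r} (a : Vec A r) → AdjacentDistinct a → Alternating (hatSymbols a) (2 + r)
  hatSymbols-alternating a adj zero    _                 =
    lookupOr-preserves (at ≢_) dollar (Vec.map ch a) (λ ()) (λ j → subst (at ≢_) (sym (lookup-map j ch a)) λ ()) 0
  hatSymbols-alternating a adj (suc k) (s≤s (s≤s k<r)) = letters-alternating a adj k k<r
    where
    letters-alternating : ∀ {r} (a : Vec A r) → AdjacentDistinct a →
      ∀ k → k < r → lookupOr dollar (Vec.map ch a) k ≢ lookupOr dollar (Vec.map ch a) (suc k)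
    letters-alternating (x ∷ [])     adj zero    _         ()
    letters-alternating (x ∷ y ∷ ys) adj zero    _         refl = adj Fin.zero (Fin.suc Fin.zero) refl refl
    letters-alternating (x ∷ xs)     adj (suc k) (s≤s k<r) =
      letters-alternating xs (λ i j j≡ → adj (Fin.suc i) (Fin.suc j) (cong suc j≡)) k k<r

  flashback-expand : ∀ {r} (_≟A_ : DecidableEquality A) (a : Vec A r) m → AdjacentDistinct a → (∀ j → lookup m j ≥ 1) →
    flashback _≟A_ (expand a m) ≡ tokens (hatSymbols a) (hatLengths m) (2 + r)
  flashback-expand {r} _≟A_ a m adj pos = begin
    flashbackSpan _≟A_ (length (hat _≟A_ (expand a m))) (hat _≟A_ (expand a m))
      ≡⟨ cong (λ w → flashbackSpan _≟A_ (length w) w) (hat-expand _≟A_ a m) ⟩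
    flashbackSpan _≟A_ (length (runString c n (2 + r))) (runString c n (2 + r))
      ≡⟨ flashbackSpan-runString _≟A_ c n (2 + r) (length-runString c n (2 + r) pos′) pos′ (hatSymbols-alternating a adj) ⟩
    tokens c n (2 + r) ∎
    where
    c = hatSymbols a
    n = hatLengths m
    pos′ = hatLengths-positive m pos

depth-hat : ∀ r k → depth (2 + r) (suc k) ≡ (k + 1) ⊓ ((r + 1) ∸ (k + 1))
depth-hat r k rewrite +-comm k 1 | +-comm r 1 = refl

ChangedRunAt-hat : ∀ {r} (m m′ : Vec ℕ r) d →
  ChangedRunAt (hatLengths m) (hatLengths m′) (2 + r) d
    ⇔ Σ (Fin r) (λ j → lookup m j ≢ lookup m′ j × d ≡ (toℕ j + 1) ⊓ ((r + 1) ∸ (toℕ j + 1)))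
ChangedRunAt-hat {r} m m′ d = mk⇔ to from
  where
  to : ChangedRunAt (hatLengths m) (hatLengths m′) (2 + r) d →
       Σ (Fin r) (λ j → lookup m j ≢ lookup m′ j × d ≡ (toℕ j + 1) ⊓ ((r + 1) ∸ (toℕ j + 1)))
  to (zero  , _ , ≢ , _)  = ⊥-elim (≢ refl)
  to (suc i , _ , ≢ , d≡) with lookupOr-≢ m m′ i ≢
  ... | j , refl , ≢j = j , ≢j , trans d≡ (depth-hat r (toℕ j))

  from : Σ (Fin r) (λ j → lookup m j ≢ lookup m′ j × d ≡ (toℕ j + 1) ⊓ ((r + 1) ∸ (toℕ j + 1))) →
         ChangedRunAt (hatLengths m) (hatLengths m′) (2 + r) d
  from (j , ≢ , d≡) =
    suc (toℕ j) , s≤s (m<n⇒m<1+n (toℕ<n j)) ,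
    (λ ≡j → ≢ (trans (sym (lookupOr-toℕ 1 m j)) (trans ≡j (lookupOr-toℕ 1 m′ j)))) ,
    trans d≡ (sym (depth-hat r (toℕ j)))

mainTheorem12 :
    {A : Set} (_≟A_ : DecidableEquality A)
    (r : ℕ) (a : Vec A r) (m m′ : Vec ℕ r) →
    -- consecutive run symbols are distinct: a_i ≠ a_{i+1}
    ((i j : Fin r) → toℕ j ≡ suc (toℕ i) → lookup a i ≢ lookup a j) →
    -- all run lengths are ≥ 1
    ((i : Fin r) → lookup m i ≥ 1) →
    ((i : Fin r) → lookup m′ i ≥ 1) →
    -- the depths d with τ_d ≠ τ′_d are exactly { min(i, r+1-i) : i ∈ D }
    -- (run index i is 1-based: the Fin index j stands for i = toℕ j + 1)
    (d : ℕ) →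
      (flashback _≟A_ (expand a m) !? d ≢ flashback _≟A_ (expand a m′) !? d)
      ⇔ Σ (Fin r) (λ j → (lookup m j ≢ lookup m′ j)
                         × (d ≡ (toℕ j + 1) ⊓ ((r + 1) ∸ (toℕ j + 1))))
mainTheorem12 _≟A_ r a m m′ adj pos pos′ d
  rewrite flashback-expand _≟A_ a m adj pos | flashback-expand _≟A_ a m′ adj pos′ =
  ⇔-trans (tokens-≢⇔ChangedRunAt {n = hatLengths m} {hatLengths m′} (2 + r) d (hatSymbols-alternating a adj))
          (ChangedRunAt-hat m m′ d)
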